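{- Let $K_3$ be the $2$-colored graph on vertex set $\{1,2,3\}$ with red edges $\{12,13,23\}$ and blue edges $\{12,13,23\}$. Then for every $n$, $ex(n,K_3)=\binom{n}{2}+\left\lfloor\frac{n^2}{4}\right\rfloor$. In particular $\pi(K_3)=\frac{3}{2}$.
   Context: A $2$-colored graph is $G=(V,E_r,E_b)$ with $E_r,E_b\subseteq\binom{V}{2}$ (not necessarily disjoint). $G$ is $H$-free if it contains no sub-graph isomorphic to $H$ (red edges into red, blue edges into blue). $ex(n,H)$ is the maximum of $|E_r(G)|+|E_b(G)|$ over $H$-free $2$-colored graphs $G$ on $n$ vertices, and $\pi(H)=\lim_{n\to\infty}ex(n,H)/\binom{n}{2}$. -}

module Defs where

open import Data.Nat using (ℕ; zero; suc; _+_; _*_; _≤_; _<ᵇ_)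
open import Data.Nat.DivMod using (_/_)
open import Data.Nat.Combinatorics using (_C_)
open import Data.Bool using (Bool; true; false; _∧_; if_then_else_)
open import Data.Fin using (Fin; toℕ; zero; suc)
open import Data.List using (List; map; allFin)
open import Data.Nat.ListAction using (sum)
open import Data.Product using (Σ; _×_; ∃)
open import Function.Definitions using (Injective)
open import Relation.Binary.PropositionalEquality using (_≡_; refl)
open import Relation.Nullary using (¬_)
import Data.Rational as ℚ
open import Data.Integer using (+_)

-- A 2-colored graph on vertex set Fin n: red and blue edge sets given as
-- symmetric, irreflexive Boolean adjacency relations (edge sets need not be disjoint).
record Graph2 (n : ℕ) : Set where
  field
    red  : Fin n → Fin n → Bool
    blue : Fin n → Fin n → Bool
    red-sym   : ∀ i j → red i j ≡ red j i
    blue-sym  : ∀ i j → blue i j ≡ blue j i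
    red-irr   : ∀ i → red i i ≡ false
    blue-irr  : ∀ i → blue i i ≡ false
open Graph2 public

b2n : Bool → ℕ
b2n true  = 1
b2n false = 0

edgeCount : ∀ {n} → (Fin n → Fin n → Bool) → ℕ
edgeCount {n} e =
  sum (map (λ j → sum (map (λ i → b2n ((toℕ i <ᵇ toℕ j) ∧ e i j)) (allFin n))) (allFin n))

size : ∀ {n} → Graph2 n → ℕ
size G = edgeCount (red G) + edgeCount (blue G)

Contains : ∀ {n k} → Graph2 n → Graph2 k → Set
Contains {n} {k} G H =
  Σ (Fin k → Fin n) λ f →
    Injective _≡_ _≡_ f
    × (∀ a b → red H a b ≡ true → red G (f a) (f b) ≡ true)
    × (∀ a b → blue H a b ≡ true → blue G (f a) (f b) ≡ true)

Free : ∀ {n k} → Graph2 n → Graph2 k → Set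
Free G H = ¬ Contains G H

IsEx : ∀ {k} → ℕ → Graph2 k → ℕ → Set
IsEx n H m =
  (Σ (Graph2 n) λ G → Free G H × size G ≡ m)
  × (∀ (G : Graph2 n) → Free G H → size G ≤ m)

k3e : Fin 3 → Fin 3 → Bool
k3e zero zero = false
k3e zero (suc _) = true
k3e (suc zero) zero = true
k3e (suc zero) (suc zero) = false
k3e (suc zero) (suc (suc _)) = true
k3e (suc (suc _)) zero = true
k3e (suc (suc _)) (suc zero) = true
k3e (suc (suc zero)) (suc (suc zero)) = false

k3e-sym : ∀ i j → k3e i j ≡ k3e j i
k3e-sym zero zero = refl
k3e-sym zero (suc zero) = refl
k3e-sym zero (suc (suc zero)) = refl
k3e-sym (suc zero) zero = refl
k3e-sym (suc zero) (suc zero) = refl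
k3e-sym (suc zero) (suc (suc zero)) = refl
k3e-sym (suc (suc zero)) zero = refl
k3e-sym (suc (suc zero)) (suc zero) = refl
k3e-sym (suc (suc zero)) (suc (suc zero)) = refl

k3e-irr : ∀ i → k3e i i ≡ false
k3e-irr zero = refl
k3e-irr (suc zero) = refl
k3e-irr (suc (suc zero)) = refl

K3 : Graph2 3
K3 = record
  { red = k3e ; blue = k3e
  ; red-sym = k3e-sym ; blue-sym = k3e-sym
  ; red-irr = k3e-irr ; blue-irr = k3e-irr }

-- ratio m / C(n,2) as a rational (defined as 0 when C(n,2) = 0, i.e. n < 2)
ratio : ℕ → ℕ → ℚ.ℚ
ratio m n with n C 2
... | zero  = ℚ.0ℚ
... | suc c = (+ m) ℚ./ suc c

-- Every pair of vertices carries at most two coloured edges, and carries two exactly when it is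
-- an edge of the graph `both G` of pairs coloured both red and blue.  If G is K₃-free then
-- `both G` is triangle-free, so by Mantel's theorem it has at most ⌊n²/4⌋ edges, whence
-- |E_r| + |E_b| ≤ C(n,2) + ⌊n²/4⌋.  Equality holds for the complete red graph together with the
-- complete bipartite blue graph between even and odd vertices.  Finally
-- 2 (C(n,2) + ⌊n²/4⌋) = 3 C(n,2) + ⌊n/2⌋, so the density exceeds 3/2 by ⌊n/2⌋ / (n(n-1)) → 0.

module Submission where

open import Defs
open import Algebra.Properties.CommutativeSemigroup using (interchange)
open import Data.Bool using (Bool; true; false; _∧_; _∨_; not; _xor_)
open import Data.Bool.Properties using (∨-comm; xor-comm; xor-same; not-involutive)
open import Data.Empty using (⊥; ⊥-elim)
open import Data.Fin as Fin using (Fin; toℕ; zero; suc)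
open import Data.Fin.Patterns using (0F; 1F; 2F)
open import Data.Integer using (+_; -[1+_])
import Data.Integer as ℤ
import Data.Integer.Properties as ℤ
open import Data.Integer.Solver renaming (module +-*-Solver to ℤ-Solver)
open import Data.List using (List; []; _∷_; map; allFin; tabulate; length)
open import Data.List.Properties using (map-cong; tabulate-cong; length-tabulate)
open import Data.List.Relation.Binary.Permutation.Propositional as ↭ using (_↭_; ↭-refl; ↭-prep; ↭-swap; ↭-trans)
open import Data.List.Relation.Binary.Permutation.Propositional.Properties using (map⁺; ↭-length)
import Data.Nat as ℕ
open import Data.Nat using (ℕ; zero; suc; _+_; _*_; _≤_; _<ᵇ_; z≤n; s≤s; NonZero)
open import Data.Nat.Combinatorics using (_C_; nC1≡n; nCk+nC[k+1]≡[n+1]C[k+1])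
open import Data.Nat.Coprimality using (Coprime)
open import Data.Nat.DivMod using (_/_; m*n/n≡m; /-monoˡ-≤; /-congˡ; +-distrib-/-∣ʳ; m/n≡1+[m∸n]/n; m/n*n≤m)
open import Data.Nat.Divisibility using (divides)
open import Data.Nat.ListAction using (sum)
open import Data.Nat.ListAction.Properties using (sum-↭)
open import Data.Nat.Properties
open import Data.Nat.Solver using (module +-*-Solver)
open +-*-Solver using (solve; _:+_; _:*_; _:=_; con)
open import Data.Product using (_×_; _,_; proj₁; proj₂; ∃; ∃-syntax)
import Data.Rational as ℚ
open import Data.Rational using (ℚ; mkℚ; 0ℚ; _<_; _-_; ∣_∣; toℚᵘ)
open import Data.Rational.Properties using (toℚᵘ-homo-+; toℚᵘ-homo‿-; toℚᵘ-fromℚᵘ; toℚᵘ-cancel-<; toℚᵘ-cancel-≤; 0≤p⇒∣p∣≡p)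
open import Data.Rational.Unnormalised as ℚᵘ using (ℚᵘ; mkℚᵘ; ↥_; _≃_; *<*; *≤*)
import Data.Rational.Unnormalised.Properties as ℚᵘ
open import Data.Sum using (_⊎_; inj₁; inj₂)
open import Function using (_∘_; id)
open import Relation.Binary.PropositionalEquality using (_≡_; _≢_; refl; sym; trans; cong; cong₂; subst; subst₂; module ≡-Reasoning)
open import Relation.Nullary using (yes; no)

open import Algebra.Properties.Monoid.Sum +-0-monoid using (sum-syntax; sum-cong-≗; sum-replicate-zero)
  renaming (sum to ∑)

+-interchange : ∀ a b c d → (a + b) + (c + d) ≡ (a + c) + (b + d)
+-interchange = interchange +-commutativeSemigroup

∑-distrib-+ : ∀ n (f g : Fin n → ℕ) → ∑[ i < n ] (f i + g i) ≡ ∑[ i < n ] f i + ∑[ i < n ] g i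
∑-distrib-+ zero    f g = refl
∑-distrib-+ (suc n) f g = trans (cong (λ y → f zero + g zero + y) (∑-distrib-+ n (f ∘ suc) (g ∘ suc)))
  (+-interchange (f zero) (g zero) _ _)

sum-map-tabulate : ∀ {A : Set} n (g : Fin n → A) (h : A → ℕ) → sum (map h (tabulate g)) ≡ ∑[ i < n ] h (g i)
sum-map-tabulate zero    g h = refl
sum-map-tabulate (suc n) g h = cong (λ y → h (g zero) + y) (sum-map-tabulate n (g ∘ suc) h)

module _ {A : Set} (e : A → A → Bool) where

  degree : A → List A → ℕ
  degree x L = sum (map (λ y → b2n (e x y)) L)

  edges : List A → ℕ
  edges []      = 0
  edges (x ∷ L) = degree x L + edges L

  ∑∑-ordered≡edges : ∀ n (g : Fin n → A) →
    ∑[ j < n ] ∑[ i < n ] b2n ((toℕ i <ᵇ toℕ j) ∧ e (g i) (g j)) ≡ edges (tabulate g)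
  ∑∑-ordered≡edges zero    g = refl
  ∑∑-ordered≡edges (suc n) g = begin
    ∑[ i < suc n ] 0 + ∑[ j < n ] (b2n (e (g zero) (g (suc j))) + inner j)
      ≡⟨ cong₂ _+_ (sum-replicate-zero (suc n)) (∑-distrib-+ n _ inner) ⟩
    ∑[ j < n ] b2n (e (g zero) (g (suc j))) + ∑[ j < n ] inner j
      ≡⟨ cong₂ _+_ (sym (sum-map-tabulate n (g ∘ suc) _)) (∑∑-ordered≡edges n (g ∘ suc)) ⟩
    degree (g zero) (tabulate (g ∘ suc)) + edges (tabulate (g ∘ suc)) ∎
    where
    open ≡-Reasoning
    inner : Fin n → ℕ
    inner j = ∑[ i < n ] b2n ((toℕ i <ᵇ toℕ j) ∧ e (g (suc i)) (g (suc j)))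

edgeCount-pullback : ∀ {A : Set} {n} (e : A → A → Bool) (g : Fin n → A) →
  edgeCount (λ i j → e (g i) (g j)) ≡ edges e (tabulate g)
edgeCount-pullback {n = n} e g = begin
  edgeCount (λ i j → e (g i) (g j))
    ≡⟨ sum-map-tabulate n id _ ⟩
  ∑[ j < n ] sum (map (λ i → b2n ((toℕ i <ᵇ toℕ j) ∧ e (g i) (g j))) (allFin n))
    ≡⟨ sum-cong-≗ (λ j → sum-map-tabulate n id (λ i → b2n ((toℕ i <ᵇ toℕ j) ∧ e (g i) (g j)))) ⟩
  ∑[ j < n ] ∑[ i < n ] b2n ((toℕ i <ᵇ toℕ j) ∧ e (g i) (g j))
    ≡⟨ ∑∑-ordered≡edges e n g ⟩
  edges e (tabulate g) ∎
  where open ≡-Reasoning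

edgeCount≡edges : ∀ {n} (e : Fin n → Fin n → Bool) → edgeCount e ≡ edges e (allFin n)
edgeCount≡edges e = edgeCount-pullback e id

edgeCount-cong : ∀ {n} {e e′ : Fin n → Fin n → Bool} →
  (∀ i j → (toℕ i <ᵇ toℕ j) ∧ e i j ≡ (toℕ i <ᵇ toℕ j) ∧ e′ i j) → edgeCount e ≡ edgeCount e′
edgeCount-cong {n} same-above-diagonal =
  cong sum (map-cong (λ j → cong sum (map-cong (λ i → cong b2n (same-above-diagonal i j)) (allFin n))) (allFin n))

+-interchange-mono-≤ : ∀ a b c d a′ b′ c′ d′ → a + c ≤ a′ + c′ → b + d ≤ b′ + d′ →
  (a + b) + (c + d) ≤ (a′ + b′) + (c′ + d′)
+-interchange-mono-≤ a b c d a′ b′ c′ d′ ac bd = begin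
  (a + b) + (c + d)     ≡⟨ +-interchange a b c d ⟩
  (a + c) + (b + d)     ≤⟨ +-mono-≤ ac bd ⟩
  (a′ + c′) + (b′ + d′) ≡⟨ +-interchange a′ c′ b′ d′ ⟩
  (a′ + b′) + (c′ + d′) ∎
  where open ≤-Reasoning

sum-map-+-≤ : ∀ {A : Set} {f g f′ g′ : A → ℕ} → (∀ x → f x + g x ≤ f′ x + g′ x) →
  ∀ L → sum (map f L) + sum (map g L) ≤ sum (map f′ L) + sum (map g′ L)
sum-map-+-≤ pointwise []      = z≤n
sum-map-+-≤ {f = f} {g} {f′} {g′} pointwise (x ∷ L) =
  +-interchange-mono-≤ (f x) (sum (map f L)) (g x) (sum (map g L))
                       (f′ x) (sum (map f′ L)) (g′ x) (sum (map g′ L))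
                       (pointwise x) (sum-map-+-≤ pointwise L)

edges-+-≤ : ∀ {A : Set} {r b s t : A → A → Bool} →
  (∀ x y → b2n (r x y) + b2n (b x y) ≤ b2n (s x y) + b2n (t x y)) →
  ∀ L → edges r L + edges b L ≤ edges s L + edges t L
edges-+-≤ pointwise []      = z≤n
edges-+-≤ {r = r} {b} {s} {t} pointwise (x ∷ L) =
  +-interchange-mono-≤ (degree r x L) (edges r L) (degree b x L) (edges b L)
                       (degree s x L) (edges s L) (degree t x L) (edges t L)
                       (sum-map-+-≤ (pointwise x) L) (edges-+-≤ pointwise L)

[1+n]C2≡n+nC2 : ∀ n → suc n C 2 ≡ n + n C 2
[1+n]C2≡n+nC2 n = trans (sym (nCk+nC[k+1]≡[n+1]C[k+1] n 1)) (cong (_+ n C 2) (nC1≡n n))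

edges-complete : ∀ {A : Set} (L : List A) → edges (λ _ _ → true) L ≡ length L C 2
edges-complete []      = refl
edges-complete (x ∷ L) = trans (cong₂ _+_ (degree-complete L) (edges-complete L)) (sym ([1+n]C2≡n+nC2 (length L)))
  where
  degree-complete : ∀ L → degree (λ _ _ → true) x L ≡ length L
  degree-complete []      = refl
  degree-complete (_ ∷ L) = cong suc (degree-complete L)

edgeCount-complete : ∀ n → edgeCount {n} (λ _ _ → true) ≡ n C 2
edgeCount-complete n = trans (edgeCount≡edges {n} (λ _ _ → true))
  (trans (edges-complete (allFin n)) (cong (_C 2) (length-tabulate {n = n} id)))

degree-↭ : ∀ {A : Set} (e : A → A → Bool) x {L L′} → L ↭ L′ → degree e x L ≡ degree e x L′
degree-↭ e x p = sum-↭ (map⁺ _ p)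

module _ {A : Set} {e : A → A → Bool} (e-sym : ∀ x y → e x y ≡ e y x) where

  edges-↭ : ∀ {L L′} → L ↭ L′ → edges e L ≡ edges e L′
  edges-↭ ↭.refl         = refl
  edges-↭ (↭.prep x p)   = cong₂ _+_ (degree-↭ e x p) (edges-↭ p)
  edges-↭ (↭.trans p q)  = trans (edges-↭ p) (edges-↭ q)
  edges-↭ (↭.swap {xs} {ys} x y p) = begin
    (b2n (e x y) + degree e x xs) + (degree e y xs + edges e xs)
      ≡⟨ cong₂ _+_ (cong₂ _+_ (cong b2n (e-sym x y)) (degree-↭ e x p)) (cong₂ _+_ (degree-↭ e y p) (edges-↭ p)) ⟩
    (b2n (e y x) + degree e x ys) + (degree e y ys + edges e ys)
      ≡⟨ +-interchange (b2n (e y x)) (degree e x ys) (degree e y ys) (edges e ys) ⟩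
    (b2n (e y x) + degree e y ys) + (degree e x ys + edges e ys) ∎
    where open ≡-Reasoning

  edges-∷-neighbour : ∀ {x y L L′} → e x y ≡ true → L ↭ y ∷ L′ →
    edges e (x ∷ L) ≡ suc ((degree e x L′ + degree e y L′) + edges e L′)
  edges-∷-neighbour {x} {y} {L} {L′} exy p = begin
    degree e x L + edges e L
      ≡⟨ cong₂ _+_ (degree-↭ e x p) (edges-↭ p) ⟩
    (b2n (e x y) + degree e x L′) + (degree e y L′ + edges e L′)
      ≡⟨ cong (λ b → (b2n b + degree e x L′) + (degree e y L′ + edges e L′)) exy ⟩
    suc (degree e x L′ + (degree e y L′ + edges e L′))
      ≡⟨ cong suc (+-assoc (degree e x L′) (degree e y L′) (edges e L′)) ⟨
    suc ((degree e x L′ + degree e y L′) + edges e L′) ∎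
    where open ≡-Reasoning

isolated-or-neighbour : ∀ {A : Set} (e : A → A → Bool) x L →
  degree e x L ≡ 0 ⊎ ∃[ y ] ∃[ L′ ] (e x y ≡ true × L ↭ y ∷ L′)
isolated-or-neighbour e x []      = inj₁ refl
isolated-or-neighbour e x (z ∷ L) with e x z in exz
... | true  = inj₂ (z , L , exz , ↭-refl)
... | false with isolated-or-neighbour e x L
...   | inj₁ isolated = inj₁ isolated
...   | inj₂ (y , L′ , exy , p) = inj₂ (y , z ∷ L′ , exy , ↭-trans (↭-prep z p) (↭-swap z y ↭-refl))

TriangleFree : {A : Set} → (A → A → Bool) → Set
TriangleFree e = ∀ x y z → e x y ≡ true → e y z ≡ true → e x z ≡ true → ⊥

module _ {A : Set} {e : A → A → Bool} (e-sym : ∀ x y → e x y ≡ e y x) (triangle-free : TriangleFree e) where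

  adjacent⇒degree+degree≤length : ∀ {x y} → e x y ≡ true → ∀ L → degree e x L + degree e y L ≤ length L
  adjacent⇒degree+degree≤length exy []      = z≤n
  adjacent⇒degree+degree≤length {x} {y} exy (z ∷ L) = begin
    (b2n (e x z) + degree e x L) + (b2n (e y z) + degree e y L)
      ≡⟨ +-interchange (b2n (e x z)) (degree e x L) (b2n (e y z)) (degree e y L) ⟩
    (b2n (e x z) + b2n (e y z)) + (degree e x L + degree e y L)
      ≤⟨ +-mono-≤ at-most-one (adjacent⇒degree+degree≤length exy L) ⟩
    suc (length L) ∎
    where
    open ≤-Reasoning
    at-most-one : b2n (e x z) + b2n (e y z) ≤ 1
    at-most-one with e x z in exz | e y z in eyz
    ... | true  | true  = ⊥-elim (triangle-free x y z exy eyz exz)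
    ... | true  | false = ≤-refl
    ... | false | true  = ≤-refl
    ... | false | false = z≤n

  mantel : ∀ L → 4 * edges e L ≤ length L * length L
  mantel L = mantel-bounded (length L) L ≤-refl
    where
    -- Delete both ends of an edge x y: as no vertex is adjacent to both, at most |L′| + 1 edges
    -- disappear.  The recursive call is on L′, so the induction is on a bound k for the length.
    mantel-bounded : ∀ k L → length L ≤ k → 4 * edges e L ≤ length L * length L
    mantel-bounded k       []      _          = z≤n
    mantel-bounded (suc k) (x ∷ L) (s≤s |L|≤k) with isolated-or-neighbour e x L
    ... | inj₁ isolated = begin
      4 * (degree e x L + edges e L) ≡⟨ cong (λ d → 4 * (d + edges e L)) isolated ⟩
      4 * edges e L                  ≤⟨ mantel-bounded k L |L|≤k ⟩
      length L * length L            ≤⟨ *-mono-≤ (n≤1+n (length L)) (n≤1+n (length L)) ⟩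
      suc (length L) * suc (length L) ∎
      where open ≤-Reasoning
    ... | inj₂ (y , L′ , exy , p) = begin
      4 * edges e (x ∷ L)            ≡⟨ cong (4 *_) (edges-∷-neighbour e-sym exy p) ⟩
      4 * suc (d + edges e L′)       ≡⟨ *-suc 4 (d + edges e L′) ⟩
      4 + 4 * (d + edges e L′)       ≡⟨ cong (λ y → 4 + y) (*-distribˡ-+ 4 d (edges e L′)) ⟩
      4 + (4 * d + 4 * edges e L′)
        ≤⟨ +-monoʳ-≤ 4 (+-mono-≤ (*-monoʳ-≤ 4 (adjacent⇒degree+degree≤length exy L′)) (mantel-bounded k L′ |L′|≤k)) ⟩
      4 + (4 * l + l * l)
        ≡⟨ solve 1 (λ l → con 4 :+ (con 4 :* l :+ l :* l) := (con 2 :+ l) :* (con 2 :+ l)) refl l ⟩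
      suc (suc l) * suc (suc l)      ≡⟨ cong (λ m → suc m * suc m) (↭-length p) ⟨
      suc (length L) * suc (length L) ∎
      where
      open ≤-Reasoning
      d = degree e x L′ + degree e y L′
      l = length L′
      |L′|≤k : l ≤ k
      |L′|≤k = ≤-trans (n≤1+n l) (subst (_≤ k) (↭-length p) |L|≤k)

both : ∀ {n} → Graph2 n → Fin n → Fin n → Bool
both G i j = red G i j ∧ blue G i j

∧-true : ∀ {a b} → a ∧ b ≡ true → a ≡ true × b ≡ true
∧-true {true} {true} refl = refl , refl

k3e-complete : ∀ {a b} → a ≢ b → k3e a b ≡ true
k3e-complete {zero}             {zero}             a≢b = ⊥-elim (a≢b refl)
k3e-complete {zero}             {suc _}            _   = refl
k3e-complete {suc zero}         {zero}             _   = refl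
k3e-complete {suc zero}         {suc zero}         a≢b = ⊥-elim (a≢b refl)
k3e-complete {suc zero}         {suc (suc _)}      _   = refl
k3e-complete {suc (suc _)}      {zero}             _   = refl
k3e-complete {suc (suc _)}      {suc zero}         _   = refl
k3e-complete {suc (suc zero)}   {suc (suc zero)}   a≢b = ⊥-elim (a≢b refl)

module _ {n} (G : Graph2 n) where

  both-sym : ∀ i j → both G i j ≡ both G j i
  both-sym i j = cong₂ _∧_ (red-sym G i j) (blue-sym G i j)

  both-distinct : ∀ {i j} → both G i j ≡ true → i ≢ j
  both-distinct {i} ij refl with () ← trans (sym (cong (_∧ blue G i i) (red-irr G i))) ij

  both-triangle⇒Contains-K3 : ∀ {x y z} → both G x y ≡ true → both G y z ≡ true → both G x z ≡ true →
    Contains G K3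
  both-triangle⇒Contains-K3 {x} {y} {z} xy yz xz =
    f , f-injective , (λ a b → proj₁ ∘ ∧-true ∘ edge a b) , (λ a b → proj₂ ∘ ∧-true ∘ edge a b)
    where
    f : Fin 3 → Fin n
    f zero             = x
    f (suc zero)       = y
    f (suc (suc zero)) = z
    edge : ∀ a b → k3e a b ≡ true → both G (f a) (f b) ≡ true
    edge zero             zero             ()
    edge zero             (suc zero)       _ = xy
    edge zero             (suc (suc zero)) _ = xz
    edge (suc zero)       zero             _ = trans (both-sym y x) xy
    edge (suc zero)       (suc zero)       ()
    edge (suc zero)       (suc (suc zero)) _ = yz
    edge (suc (suc zero)) zero             _ = trans (both-sym z x) xz
    edge (suc (suc zero)) (suc zero)       _ = trans (both-sym z y) yz
    edge (suc (suc zero)) (suc (suc zero)) ()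
    f-injective : ∀ {a b} → f a ≡ f b → a ≡ b
    f-injective {a} {b} fa≡fb with a Fin.≟ b
    ... | yes a≡b = a≡b
    ... | no  a≢b = ⊥-elim (both-distinct (edge a b (k3e-complete a≢b)) fa≡fb)

  Free-K3⇒TriangleFree-both : Free G K3 → TriangleFree (both G)
  Free-K3⇒TriangleFree-both free x y z xy yz xz = free (both-triangle⇒Contains-K3 xy yz xz)

≤-/-intro : ∀ {x m} d .{{_ : NonZero d}} → x * d ≤ m → x ≤ m / d
≤-/-intro {x} {m} d x*d≤m = subst (_≤ m / d) (m*n/n≡m x d) (/-monoˡ-≤ d x*d≤m)

b2n-+-≤ : ∀ a b → b2n a + b2n b ≤ b2n true + b2n (a ∧ b)
b2n-+-≤ true  true  = ≤-refl
b2n-+-≤ true  false = ≤-refl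
b2n-+-≤ false true  = ≤-refl
b2n-+-≤ false false = z≤n

size-≤ : ∀ {n} (G : Graph2 n) → Free G K3 → size G ≤ n C 2 + (n * n) / 4
size-≤ {n} G free = begin
  edgeCount (red G) + edgeCount (blue G)
    ≡⟨ cong₂ _+_ (edgeCount≡edges (red G)) (edgeCount≡edges (blue G)) ⟩
  edges (red G) V + edges (blue G) V
    ≤⟨ edges-+-≤ (λ i j → b2n-+-≤ (red G i j) (blue G i j)) V ⟩
  edges (λ _ _ → true) V + edges (both G) V
    ≤⟨ +-mono-≤ (≤-reflexive complete) (≤-/-intro 4 mantel-both) ⟩
  n C 2 + (n * n) / 4 ∎
  where
  open ≤-Reasoning
  V = allFin n
  |V| : length V ≡ n
  |V| = length-tabulate id
  complete : edges (λ _ _ → true) V ≡ n C 2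
  complete = trans (sym (edgeCount≡edges {n} (λ _ _ → true))) (edgeCount-complete n)
  mantel-both : edges (both G) V * 4 ≤ n * n
  mantel-both = subst₂ _≤_ (*-comm 4 (edges (both G) V)) (cong (λ l → l * l) |V|)
    (mantel (both-sym G) (Free-K3⇒TriangleFree-both G free) V)

[2+n]C2≡1+n+[n+nC2] : ∀ n → suc (suc n) C 2 ≡ suc n + (n + n C 2)
[2+n]C2≡1+n+[n+nC2] n = trans ([1+n]C2≡n+nC2 (suc n)) (cong (λ y → suc n + y) ([1+n]C2≡n+nC2 n))

[2+n]/2≡1+n/2 : ∀ n → suc (suc n) / 2 ≡ suc (n / 2)
[2+n]/2≡1+n/2 n = m/n≡1+[m∸n]/n {suc (suc n)} (s≤s (s≤s z≤n))

[2+n]*[2+n]/4≡n*n/4+[1+n] : ∀ n → suc (suc n) * suc (suc n) / 4 ≡ n * n / 4 + suc n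
[2+n]*[2+n]/4≡n*n/4+[1+n] n = begin
  suc (suc n) * suc (suc n) / 4 ≡⟨ /-congˡ (solve 1 (λ n → (con 2 :+ n) :* (con 2 :+ n) := n :* n :+ (con 1 :+ n) :* con 4) refl n) ⟩
  (n * n + suc n * 4) / 4      ≡⟨ +-distrib-/-∣ʳ (n * n) (divides (suc n) refl) ⟩
  n * n / 4 + suc n * 4 / 4    ≡⟨ cong (λ y → n * n / 4 + y) (m*n/n≡m (suc n) 4) ⟩
  n * n / 4 + suc n            ∎
  where open ≡-Reasoning

n*n/4*2≡n/2+nC2 : ∀ n → n * n / 4 * 2 ≡ n / 2 + n C 2
n*n/4*2≡n/2+nC2 zero          = refl
n*n/4*2≡n/2+nC2 (suc zero)    = refl
n*n/4*2≡n/2+nC2 (suc (suc n)) = begin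
  suc (suc n) * suc (suc n) / 4 * 2 ≡⟨ cong (_* 2) ([2+n]*[2+n]/4≡n*n/4+[1+n] n) ⟩
  (n * n / 4 + suc n) * 2           ≡⟨ *-distribʳ-+ 2 (n * n / 4) (suc n) ⟩
  n * n / 4 * 2 + suc n * 2         ≡⟨ cong (_+ suc n * 2) (n*n/4*2≡n/2+nC2 n) ⟩
  n / 2 + n C 2 + suc n * 2
    ≡⟨ solve 3 (λ h c n → h :+ c :+ (con 1 :+ n) :* con 2 := (con 1 :+ h) :+ ((con 1 :+ n) :+ (n :+ c))) refl (n / 2) (n C 2) n ⟩
  suc (n / 2) + (suc n + (n + n C 2))
    ≡⟨ sym (cong₂ _+_ ([2+n]/2≡1+n/2 n) ([2+n]C2≡1+n+[n+nC2] n)) ⟩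
  suc (suc n) / 2 + suc (suc n) C 2 ∎
  where open ≡-Reasoning

n/2*n≤nC2*2 : ∀ n → n / 2 * n ≤ (n C 2) * 2
n/2*n≤nC2*2 zero          = z≤n
n/2*n≤nC2*2 (suc zero)    = z≤n
n/2*n≤nC2*2 (suc (suc n)) = begin
  suc (suc n) / 2 * suc (suc n)         ≡⟨ cong (_* suc (suc n)) ([2+n]/2≡1+n/2 n) ⟩
  suc (n / 2) * suc (suc n)
    ≡⟨ solve 2 (λ h n → (con 1 :+ h) :* (con 2 :+ n) := h :* n :+ (h :* con 2 :+ (con 2 :+ n))) refl (n / 2) n ⟩
  n / 2 * n + (n / 2 * 2 + suc (suc n)) ≤⟨ +-mono-≤ (n/2*n≤nC2*2 n) (+-monoˡ-≤ (suc (suc n)) (m/n*n≤m n 2)) ⟩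
  (n C 2) * 2 + (n + suc (suc n))         ≤⟨ +-monoʳ-≤ ((n C 2) * 2) (+-monoˡ-≤ (suc (suc n)) (m≤m+n n (n + n))) ⟩
  (n C 2) * 2 + (n + (n + n) + suc (suc n))
    ≡⟨ solve 2 (λ c n → c :* con 2 :+ (n :+ (n :+ n) :+ (con 2 :+ n)) := (con 1 :+ n :+ (n :+ c)) :* con 2) refl (n C 2) n ⟩
  (suc n + (n + n C 2)) * 2
    ≡⟨ sym (cong (_* 2) ([2+n]C2≡1+n+[n+nC2] n)) ⟩
  (suc (suc n) C 2) * 2 ∎
  where open ≤-Reasoning

trues falses : List Bool → ℕ
trues  L = sum (map b2n L)
falses L = sum (map (b2n ∘ not) L)

trues+falses≡length : ∀ L → trues L + falses L ≡ length L
trues+falses≡length []          = refl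
trues+falses≡length (true ∷ L)  = cong suc (trues+falses≡length L)
trues+falses≡length (false ∷ L) = trans (+-suc (trues L) (falses L)) (cong suc (trues+falses≡length L))

edges-xor : ∀ L → edges _xor_ L ≡ trues L * falses L
edges-xor []          = refl
edges-xor (true ∷ L)  = cong (λ y → falses L + y) (edges-xor L)
edges-xor (false ∷ L) = trans (cong (λ y → trues L + y) (edges-xor L)) (sym (*-suc (trues L) (falses L)))

xor-triangle-free : TriangleFree _xor_
xor-triangle-free true  false true  _ _ ()
xor-triangle-free false true  false _ _ ()

parity : ∀ {n} → Fin n → Bool
parity zero    = true
parity (suc i) = not (parity i)

parities : ℕ → List Bool
parities n = tabulate (parity {n})

parities-+2 : ∀ n → parities (suc (suc n)) ≡ true ∷ false ∷ parities n
parities-+2 n = cong (λ L → true ∷ false ∷ L) (tabulate-cong (not-involutive ∘ parity))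

edges-xor-parities : ∀ n → edges _xor_ (parities n) ≡ n * n / 4
edges-xor-parities n = trans (edges-xor (parities n)) (trues*falses n)
  where
  trues*falses : ∀ n → trues (parities n) * falses (parities n) ≡ n * n / 4
  trues*falses zero          = refl
  trues*falses (suc zero)    = refl
  trues*falses (suc (suc n)) = begin
    trues (parities (2 + n)) * falses (parities (2 + n))
      ≡⟨ cong (λ L → trues L * falses L) (parities-+2 n) ⟩
    suc t * suc f
      ≡⟨ solve 2 (λ t f → (con 1 :+ t) :* (con 1 :+ f) := t :* f :+ (con 1 :+ (t :+ f))) refl t f ⟩
    t * f + suc (t + f)
      ≡⟨ cong₂ (λ a b → a + suc b) (trues*falses n) (trans (trues+falses≡length (parities n)) (length-tabulate parity)) ⟩
    n * n / 4 + suc n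
      ≡⟨ sym ([2+n]*[2+n]/4≡n*n/4+[1+n] n) ⟩
    (2 + n) * (2 + n) / 4 ∎
    where
    open ≡-Reasoning
    t = trues (parities n)
    f = falses (parities n)

<ᵇ-irrefl : ∀ m → (m <ᵇ m) ≡ false
<ᵇ-irrefl zero    = refl
<ᵇ-irrefl (suc m) = <ᵇ-irrefl m

distinct : ∀ {n} → Fin n → Fin n → Bool
distinct i j = (toℕ i <ᵇ toℕ j) ∨ (toℕ j <ᵇ toℕ i)

extremal : ∀ n → Graph2 n
extremal n = record
  { red      = distinct
  ; blue     = λ i j → parity i xor parity j
  ; red-sym  = λ i j → ∨-comm (toℕ i <ᵇ toℕ j) (toℕ j <ᵇ toℕ i)
  ; blue-sym = λ i j → xor-comm (parity i) (parity j)
  ; red-irr  = λ i → cong (λ b → b ∨ b) (<ᵇ-irrefl (toℕ i))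
  ; blue-irr = λ i → xor-same (parity i)
  }

extremal-free : ∀ n → Free (extremal n) K3
extremal-free n (f , _ , _ , blue-edge) =
  xor-triangle-free (parity (f 0F)) (parity (f 1F)) (parity (f 2F))
    (blue-edge 0F 1F refl) (blue-edge 1F 2F refl) (blue-edge 0F 2F refl)

size-extremal : ∀ n → size (extremal n) ≡ n C 2 + n * n / 4
size-extremal n = cong₂ _+_ red-count (trans (edgeCount-pullback {n = n} _xor_ parity) (edges-xor-parities n))
  where
  absorb : ∀ c d → c ∧ (c ∨ d) ≡ c ∧ true
  absorb true  _ = refl
  absorb false _ = refl
  red-count : edgeCount (distinct {n}) ≡ n C 2
  red-count = trans (edgeCount-cong {n} (λ i j → absorb (toℕ i <ᵇ toℕ j) (toℕ j <ᵇ toℕ i))) (edgeCount-complete n)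

IsEx-unique : ∀ {k n m m′} {H : Graph2 k} → IsEx n H m → IsEx n H m′ → m ≡ m′
IsEx-unique ((G , G-free , refl) , maximal) ((G′ , G′-free , refl) , maximal′) =
  ≤-antisym (maximal′ G G-free) (maximal G′ G′-free)

ex-K3 : ∀ n → IsEx n K3 (n C 2 + n * n / 4)
ex-K3 n = (extremal n , extremal-free n , size-extremal n) , size-≤

∣m/c-a/b∣<ε : ∀ m c a b k p q .(cop : Coprime (suc p) (suc q)) →
  m * suc b ≡ suc c * a + k → k * suc q ℕ.< suc p * (suc c * suc b) →
  ∣ (+ m) ℚ./ suc c - (+ a) ℚ./ suc b ∣ < mkℚ (+ suc p) q cop
∣m/c-a/b∣<ε m c a b k p q cop excess lt = subst (_< _) (sym (0≤p⇒∣p∣≡p 0≤x)) x<ε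
  where
  -- In ℚᵘ the difference is the unreduced fraction k / ((1 + c)(1 + b)).
  x : ℚ
  x = (+ m) ℚ./ suc c - (+ a) ℚ./ suc b
  y : ℚᵘ
  y = mkℚᵘ (+ m) c ℚᵘ.- mkℚᵘ (+ a) b
  y≃x : y ≃ toℚᵘ x
  y≃x = ℚᵘ.≃-sym (ℚᵘ.≃-trans (toℚᵘ-homo-+ ((+ m) ℚ./ suc c) (ℚ.- ((+ a) ℚ./ suc b)))
          (ℚᵘ.+-cong (toℚᵘ-fromℚᵘ (mkℚᵘ (+ m) c))
                     (ℚᵘ.≃-trans (toℚᵘ-homo‿- ((+ a) ℚ./ suc b)) (ℚᵘ.-‿cong (toℚᵘ-fromℚᵘ (mkℚᵘ (+ a) b))))))
  ↥y≡k : ↥ y ≡ + k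
  ↥y≡k = begin
    + m ℤ.* + suc b ℤ.+ ℤ.- (+ a) ℤ.* + suc c         ≡⟨ cong (ℤ._+ ℤ.- (+ a) ℤ.* + suc c) m[1+b]≡[1+c]a+k ⟩
    + suc c ℤ.* + a ℤ.+ + k ℤ.+ ℤ.- (+ a) ℤ.* + suc c
      ≡⟨ ℤ-Solver.solve 3 (λ C A K → C ℤ-Solver.:* A ℤ-Solver.:+ K ℤ-Solver.:+ ℤ-Solver.:- A ℤ-Solver.:* C ℤ-Solver.:= K)
                          refl (+ suc c) (+ a) (+ k) ⟩
    + k ∎
    where
    open ≡-Reasoning
    m[1+b]≡[1+c]a+k : + m ℤ.* + suc b ≡ + suc c ℤ.* + a ℤ.+ + k
    m[1+b]≡[1+c]a+k = begin
      + m ℤ.* + suc b         ≡⟨ ℤ.pos-* m (suc b) ⟨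
      + (m * suc b)           ≡⟨ cong +_ excess ⟩
      + (suc c * a + k)       ≡⟨ ℤ.pos-+ (suc c * a) k ⟩
      + (suc c * a) ℤ.+ + k   ≡⟨ cong (ℤ._+ + k) (ℤ.pos-* (suc c) a) ⟩
      + suc c ℤ.* + a ℤ.+ + k ∎
  0≤x : 0ℚ ℚ.≤ x
  0≤x = toℚᵘ-cancel-≤ (ℚᵘ.≤-respʳ-≃ y≃x (*≤* (subst (λ t → + 0 ℤ.≤ t ℤ.* + 1) (sym ↥y≡k)
          (subst (+ 0 ℤ.≤_) (ℤ.pos-* k 1) (ℤ.+≤+ z≤n)))))
  x<ε : x < mkℚ (+ suc p) q cop
  x<ε = toℚᵘ-cancel-< (ℚᵘ.<-respˡ-≃ y≃x (*<* (subst (λ t → t ℤ.* + suc q ℤ.< + suc p ℤ.* + (suc c * suc b)) (sym ↥y≡k)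
          (subst₂ ℤ._<_ (ℤ.pos-* k (suc q)) (ℤ.pos-* (suc p) (suc c * suc b)) (ℤ.+<+ lt)))))

ex-K3*2 : ∀ n → (n C 2 + n * n / 4) * 2 ≡ (n C 2) * 3 + n / 2
ex-K3*2 n = begin
  (n C 2 + n * n / 4) * 2       ≡⟨ *-distribʳ-+ 2 (n C 2) (n * n / 4) ⟩
  (n C 2) * 2 + n * n / 4 * 2   ≡⟨ cong (λ y → (n C 2) * 2 + y) (n*n/4*2≡n/2+nC2 n) ⟩
  (n C 2) * 2 + (n / 2 + n C 2) ≡⟨ solve 2 (λ c h → c :* con 2 :+ (h :+ c) := c :* con 3 :+ h) refl (n C 2) (n / 2) ⟩
  (n C 2) * 3 + n / 2           ∎
  where open ≡-Reasoning

n/2*[1+q]<[1+p]*[nC2*2] : ∀ n p q → suc (suc q) ≤ n → n / 2 * suc q ℕ.< suc p * ((n C 2) * 2)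
n/2*[1+q]<[1+p]*[nC2*2] (suc (suc n)) p q (s≤s (s≤s q≤n)) = begin-strict
  suc (suc n) / 2 * suc q       ≡⟨ cong (_* suc q) ([2+n]/2≡1+n/2 n) ⟩
  suc (n / 2) * suc q           <⟨ *-monoʳ-< (suc (n / 2)) (s≤s (s≤s q≤n)) ⟩
  suc (n / 2) * suc (suc n)     ≡⟨ cong (_* suc (suc n)) ([2+n]/2≡1+n/2 n) ⟨
  suc (suc n) / 2 * suc (suc n) ≤⟨ n/2*n≤nC2*2 (suc (suc n)) ⟩
  (suc (suc n) C 2) * 2         ≤⟨ m≤n*m _ (suc p) ⟩
  suc p * ((suc (suc n) C 2) * 2) ∎
  where open ≤-Reasoning

ratio-≡ : ∀ m n c → n C 2 ≡ suc c → ratio m n ≡ (+ m) ℚ./ suc c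
ratio-≡ m n c nC2≡1+c with n C 2
ratio-≡ m n c refl | .(suc c) = refl

ratio-ex-K3 : ∀ {p q} .(cop : Coprime (suc p) (suc q)) n m → suc (suc q) ≤ n → IsEx n K3 m →
  ∣ ratio m n - (+ 3) ℚ./ 2 ∣ < mkℚ (+ suc p) q cop
ratio-ex-K3 {p} {q} cop (suc (suc n)) m q+2≤n@(s≤s (s≤s _)) ex-m =
  subst (λ r → ∣ r - (+ 3) ℚ./ 2 ∣ < mkℚ (+ suc p) q cop) (sym (ratio-≡ m N c NC2≡1+c))
    (∣m/c-a/b∣<ε m c 3 1 (N / 2) p q cop m*2≡[1+c]*3+N/2 (subst (λ C → N / 2 * suc q ℕ.< suc p * (C * 2)) NC2≡1+c
      (n/2*[1+q]<[1+p]*[nC2*2] N p q q+2≤n)))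
  where
  N = suc (suc n)
  c = n + (n + n C 2)
  NC2≡1+c : N C 2 ≡ suc c
  NC2≡1+c = [2+n]C2≡1+n+[n+nC2] n
  m*2≡[1+c]*3+N/2 : m * 2 ≡ suc c * 3 + N / 2
  m*2≡[1+c]*3+N/2 = trans (cong (_* 2) (IsEx-unique {H = K3} ex-m (ex-K3 N)))
    (trans (ex-K3*2 N) (cong (λ C → C * 3 + N / 2) NC2≡1+c))

mainTheorem6 :
    ((n : ℕ) → IsEx n K3 ((n C 2) + (n * n) / 4))
    × (∀ (ε : ℚ) → 0ℚ < ε → ∃ λ N → ∀ n m → N ≤ n → IsEx n K3 m →
         ∣ ratio m n - (+ 3) Data.Rational./ 2 ∣ < ε)
mainTheorem6 = ex-K3 , converges
  where
  converges : ∀ (ε : ℚ) → 0ℚ < ε → ∃ λ N → ∀ n m → N ≤ n → IsEx n K3 m →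
    ∣ ratio m n - (+ 3) Data.Rational./ 2 ∣ < ε
  converges (mkℚ (+ suc p) q cop) _ = suc (suc q) , ratio-ex-K3 cop
  converges (mkℚ (+ 0)     _ _) (ℚ.*<* (ℤ.+<+ ()))
  converges (mkℚ -[1+ _ ]  _ _) (ℚ.*<* ())
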